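{- Let $\mathcal R=(R,\oplus,\le,0)$ be a distance magma and $S\subseteq R$ with $0\in S$. Let $S^{\mathrm{qf}}_2(T_{\mathrm{MS}}(S,\mathcal R))$ be the set of complete quantifier-free $\mathcal L_S$-types $p(x,y)$ (without parameters) in two variables such that $p(x,y)\cup T_{\mathrm{MS}}(S,\mathcal R)$ is consistent. Then the map $\alpha\mapsto p_\alpha(x,y)$ is a bijection from $S^*$ onto $S^{\mathrm{qf}}_2(T_{\mathrm{MS}}(S,\mathcal R))$ (where $p_\alpha(x,y)$ is identified with the unique complete quantifier-free type consistent with $T_{\mathrm{MS}}(S,\mathcal R)$ containing it).
   Context: A distance magma is a structure $(R,\oplus,\le,0)$ with $\oplus$ binary, $0\in R$, such that $\le$ is a total order, $r\le r\oplus s$, $r\le t,s\le u\Rightarrow r\oplus s\le t\oplus u$, $\oplus$ commutative, $0$ an identity. $\mathcal L_S$ has binary relation symbols $d(x,y)\le s$ ($s\in S$); $d(x,y)>s$ denotes the negation. $T_{\mathrm{MS}}(S,\mathcal R)$ is the $\mathcal L_S$-theory: $\forall x\forall y(d(x,y)\le0\leftrightarrow x=y)$; $\forall x\forall y(d(x,y)\le s\leftrightarrow d(y,x)\le s)$ for $s\in S$; for $r,s,t\in S$ with no $x\in S$ satisfying $t<x\le r\oplus s$, $\forall x\forall y\forall z((d(x,y)\le r\wedge d(y,z)\le s)\to d(x,z)\le t)$; if $S$ has a maximum $s$, $\forall x\forall y\,d(x,y)\le s$. A cut in $S$ is an upward-closed $X\subseteq S$ containing $\max S$ if it exists; $S^*$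 is the set of cuts ordered by $X\le^*Y\iff Y\subseteq X$, with $r\in S$ identified with $\{x\in S:x\ge r\}$. For $\alpha\in S^*$, $p_\alpha(x,y)=\{d(x,y)\le s:s\in S,\alpha\le^*s\}\cup\{d(x,y)>s:s\in S,s<^*\alpha\}$. -}

module Defs where

open import Level using (0ℓ) renaming (suc to lsuc)
open import Data.Product using (Σ; Σ-syntax; ∃; _×_; _,_)
open import Data.Sum using (_⊎_)
open import Data.Empty using (⊥)
open import Data.Unit using (⊤)
open import Relation.Nullary using (¬_)
open import Relation.Binary.Core using (Rel)
open import Relation.Binary.Structures using (IsTotalOrder)
open import Relation.Binary.PropositionalEquality using (_≡_)
open import Relation.Unary using (Pred)

record DistanceMagma : Set₁ where
  field
    R            : Set
    _⊕_          : R → R → R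
    _≤_          : Rel R 0ℓ
    𝟘            : R
    isTotalOrder : IsTotalOrder _≡_ _≤_
    ≤-⊕          : ∀ r s → r ≤ (r ⊕ s)
    ⊕-mono       : ∀ {r s t u} → r ≤ t → s ≤ u → (r ⊕ s) ≤ (t ⊕ u)
    ⊕-comm       : ∀ r s → (r ⊕ s) ≡ (s ⊕ r)
    ⊕-identityˡ  : ∀ r → (𝟘 ⊕ r) ≡ r
    ⊕-identityʳ  : ∀ r → (r ⊕ 𝟘) ≡ r

  _<_ : Rel R 0ℓ
  r < s = (r ≤ s) × ¬ (r ≡ s)

data Var : Set where
  vx vy : Var

-- Everything below is relative to a distance magma 𝓡 and a subset S ⊆ R,
-- given as a set S together with an (injective) inclusion ι : S → R.
module Setup (𝓡 : DistanceMagma) (S : Set) (ι : S → DistanceMagma.R 𝓡) where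
  open DistanceMagma 𝓡

  _≤ₛ_ : Rel S 0ℓ
  s ≤ₛ t = ι s ≤ ι t

  _<ₛ_ : Rel S 0ℓ
  s <ₛ t = ι s < ι t

  data Formula : Set where
    _≐_  : Var → Var → Formula
    dle  : Var → Var → S → Formula          -- d(u,v) ≤ s
    ⊤f ⊥f : Formula
    ¬f   : Formula → Formula
    _∧f_ _∨f_ _⇒f_ : Formula → Formula → Formula

  dgt : Var → Var → S → Formula
  dgt u v s = ¬f (dle u v s)

  record Structure : Set₁ where
    field
      M : Set
      D : S → M → M → Set      -- interpretation of d(x,y) ≤ s

  module _ (𝓜 : Structure) where
    open Structure 𝓜

    ⟦_⟧v : Var → M → M → M
    ⟦ vx ⟧v a b = a
    ⟦ vy ⟧v a b = b

    Holds : Formula → M → M → Set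
    Holds (u ≐ v)     a b = ⟦ u ⟧v a b ≡ ⟦ v ⟧v a b
    Holds (dle u v s) a b = D s (⟦ u ⟧v a b) (⟦ v ⟧v a b)
    Holds ⊤f          a b = ⊤
    Holds ⊥f          a b = ⊥
    Holds (¬f φ)      a b = ¬ Holds φ a b
    Holds (φ ∧f ψ)    a b = Holds φ a b × Holds ψ a b
    Holds (φ ∨f ψ)    a b = Holds φ a b ⊎ Holds ψ a b
    Holds (φ ⇒f ψ)    a b = Holds φ a b → Holds ψ a b

    -- 𝓜 ⊨ T_MS(S, 𝓡)   (o is the element of S with ι o = 0)
    record IsModelTMS (o : S) : Set where
      field
        ax-zero  : ∀ a b → (D o a b → a ≡ b) × (a ≡ b → D o a b)
        ax-symm  : ∀ s a b → (D s a b → D s b a) × (D s b a → D s a b)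
        ax-tri   : ∀ r s t →
                   ¬ (Σ[ u ∈ S ] ((t <ₛ u) × (ι u ≤ (ι r ⊕ ι s)))) →
                   ∀ a b c → D r a b → D s b c → D t a c
        ax-max   : ∀ m → (∀ s → s ≤ₛ m) → ∀ a b → D m a b

  QFSet : Set₁
  QFSet = Pred Formula 0ℓ

  _⊆ᶠ_ : QFSet → QFSet → Set
  p ⊆ᶠ q = ∀ φ → p φ → q φ

  _≈ᶠ_ : QFSet → QFSet → Set
  p ≈ᶠ q = (p ⊆ᶠ q) × (q ⊆ᶠ p)

  ConsistentWithTMS : S → QFSet → Set₁
  ConsistentWithTMS o p =
    Σ[ 𝓜 ∈ Structure ] (IsModelTMS 𝓜 o ×
      Σ[ a ∈ Structure.M 𝓜 ] Σ[ b ∈ Structure.M 𝓜 ] (∀ φ → p φ → Holds 𝓜 φ a b))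

  Complete : QFSet → Set
  Complete p = ∀ φ → p φ ⊎ p (¬f φ)

  IsCompleteQFType : S → QFSet → Set₁
  IsCompleteQFType o p = Complete p × ConsistentWithTMS o p

  record Cut : Set₁ where
    field
      X        : Pred S 0ℓ
      upward   : ∀ {r s} → X r → r ≤ₛ s → X s
      has-max  : ∀ m → (∀ s → s ≤ₛ m) → X m
  open Cut public

  -- elements of S are identified with the cuts {x ∈ S : x ≥ r}
  ↑ : S → Cut
  ↑ r = record
    { X = λ x → r ≤ₛ x
    ; upward = λ r≤x x≤s → IsTotalOrder.trans isTotalOrder r≤x x≤s
    ; has-max = λ m m-max → m-max r }

  _≤*_ : Cut → Cut → Set
  α ≤* β = ∀ s → X β s → X α s

  _<*_ : Cut → Cut → Set
  α <* β = (α ≤* β) × ¬ (β ≤* α)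

  _≈*_ : Cut → Cut → Set
  α ≈* β = (α ≤* β) × (β ≤* α)

  p : Cut → QFSet
  p α φ = (Σ[ s ∈ S ] ((α ≤* ↑ s) × (φ ≡ dle vx vy s)))
        ⊎ (Σ[ s ∈ S ] ((↑ s <* α) × (φ ≡ dgt vx vy s)))

-- A pair (a, b) in a model of T_MS determines the cut {s ∈ S : d(a,b) ≤ s}, and every
-- atomic formula in x, y is decided by that cut: x = y is d(x,y) ≤ 0, and d(x,x) ≤ s
-- always holds.  So the quantifier-free type of a pair is a function of its cut, which
-- gives uniqueness and surjectivity.  Conversely every cut α is the cut of a pair: of
-- the pair in a one-point model if 0 ∈ α, and otherwise of the two points of a model
-- with d(a,b) ≤ s iff s ∈ α, whose triangle axioms hold because α is upward closed and
-- the side condition of the axiom leaves no element of S strictly between t and r ⊕ s.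
module Submission where

open import Defs
open import Level using (0ℓ) renaming (suc to lsuc)
open import Axiom.ExcludedMiddle using (ExcludedMiddle)
open import Data.Bool using (Bool; true; false)
open import Data.Empty using (⊥; ⊥-elim)
open import Data.Product using (Σ-syntax; _×_; proj₁; proj₂; _,_)
open import Data.Product.Function.NonDependent.Propositional using (_×-⇔_)
open import Data.Sum using (_⊎_; inj₁; inj₂)
open import Data.Sum.Function.Propositional using (_⊎-⇔_)
open import Data.Unit using (⊤; tt)
open import Function.Bundles using (_⇔_; mk⇔; module Equivalence)
open import Function.Construct.Composition using (_⇔-∘_)
open import Function.Construct.Identity using (⇔-id)
open import Function.Definitions using (Injective)
open import Function.Related.TypeIsomorphisms using (→-cong-⇔; ¬-cong-⇔)
open import Relation.Binary.PropositionalEquality using (_≡_; refl; sym; trans; cong; subst)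
open import Relation.Binary.Structures using (IsTotalOrder)
open import Relation.Nullary using (¬_; yes; no)
open import Relation.Nullary.Decidable using (toSum)

open Equivalence using (to; from)

module CutTypes (𝓡 : DistanceMagma) (S : Set) (ι : S → DistanceMagma.R 𝓡)
                (o : S) (ιo≡𝟘 : ι o ≡ DistanceMagma.𝟘 𝓡) where
  open DistanceMagma 𝓡
  open Setup 𝓡 S ι
  open IsTotalOrder isTotalOrder using (total; antisym) renaming (refl to ≤-refl; trans to ≤-trans)

  𝟘-minimum : ∀ r → 𝟘 ≤ r
  𝟘-minimum r = subst (𝟘 ≤_) (⊕-identityˡ r) (≤-⊕ 𝟘 r)

  o-minimum : ∀ s → o ≤ₛ s
  o-minimum s = subst (_≤ ι s) (sym ιo≡𝟘) (𝟘-minimum (ι s))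

  ⊕-o-identityʳ : ∀ r → r ⊕ ι o ≡ r
  ⊕-o-identityʳ r = trans (cong (r ⊕_) ιo≡𝟘) (⊕-identityʳ r)

  Gap : S → R → Set
  Gap t B = ¬ (Σ[ u ∈ S ] ((t <ₛ u) × (ι u ≤ B)))

  gap-≤ : ∀ {s B} → B ≤ ι s → Gap s B
  gap-≤ B≤s (u , (s≤u , s≢u) , u≤B) = s≢u (antisym s≤u (≤-trans u≤B B≤s))

  ∈⇒≤*↑ : ∀ α {s} → X α s → α ≤* ↑ s
  ∈⇒≤*↑ α s∈α t s≤t = upward α s∈α s≤t

  ∈-below-∉ : ∀ α {s t} → ¬ X α s → X α t → s ≤ₛ t
  ∈-below-∉ α {s} {t} s∉α t∈α with total (ι s) (ι t)
  ... | inj₁ s≤t = s≤t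
  ... | inj₂ t≤s = ⊥-elim (s∉α (upward α t∈α t≤s))

  ∉⇒↑<* : ∀ α {s} → ¬ X α s → ↑ s <* α
  ∉⇒↑<* α s∉α = (λ t → ∈-below-∉ α s∉α) , (λ α≤*s → s∉α (α≤*s _ ≤-refl))

  Realises : (𝓝 : Structure) → Structure.M 𝓝 → Structure.M 𝓝 → QFSet → Set
  Realises 𝓝 a b q = ∀ φ → q φ → Holds 𝓝 φ a b

  distance⇒realises-p : ∀ 𝓝 {a b} α → (∀ s → Structure.D 𝓝 s a b ⇔ X α s) →
                        Realises 𝓝 a b (p α)
  distance⇒realises-p 𝓝 α D⇔X .(dle vx vy s) (inj₁ (s , α≤*s , refl)) =
    from (D⇔X s) (α≤*s s ≤-refl)
  distance⇒realises-p 𝓝 α D⇔X .(dgt vx vy s) (inj₂ (s , (_ , α≰*s) , refl)) Dsab =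
    α≰*s (∈⇒≤*↑ α (to (D⇔X s) Dsab))

  complete-realised-maximal : ∀ {q} 𝓝 {a b} → Complete q → Realises 𝓝 a b q →
                              ∀ φ → Holds 𝓝 φ a b → q φ
  complete-realised-maximal 𝓝 q-complete q-real φ φ-holds with q-complete φ
  ... | inj₁ qφ  = qφ
  ... | inj₂ q¬φ = ⊥-elim (q-real (¬f φ) q¬φ φ-holds)

  module Model (𝓝 : Structure) (model : IsModelTMS 𝓝 o) where
    open Structure 𝓝
    open IsModelTMS model

    D-zero : ∀ a b → a ≡ b ⇔ D o a b
    D-zero a b = mk⇔ (proj₂ (ax-zero a b)) (proj₁ (ax-zero a b))

    D-sym : ∀ s a b → D s a b ⇔ D s b a
    D-sym s a b = mk⇔ (proj₁ (ax-symm s a b)) (proj₂ (ax-symm s a b))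

    D-mono : ∀ {r s a b} → D r a b → r ≤ₛ s → D s a b
    D-mono {r} {s} {a} {b} Drab r≤s =
      ax-tri r o s (gap-≤ (subst (_≤ ι s) (sym (⊕-o-identityʳ (ι r))) r≤s))
             a b b Drab (to (D-zero b b) refl)

    D-refl : ∀ s a → D s a a
    D-refl s a = D-mono (to (D-zero a a) refl) (o-minimum s)

    distanceCut : M → M → Cut
    distanceCut a b = record
      { X       = λ s → D s a b
      ; upward  = D-mono
      ; has-max = λ m m-max → ax-max m m-max a b
      }

    distanceCut-realised : ∀ a b → Realises 𝓝 a b (p (distanceCut a b))
    distanceCut-realised a b = distance⇒realises-p 𝓝 (distanceCut a b) (λ s → ⇔-id _)

  AtMost : Cut → Var → Var → S → Set
  AtMost α vx vx s = ⊤
  AtMost α vy vy s = ⊤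
  AtMost α _  _  s = X α s

  TypeOf : Cut → QFSet
  TypeOf α (u ≐ v)     = AtMost α u v o
  TypeOf α (dle u v s) = AtMost α u v s
  TypeOf α ⊤f          = ⊤
  TypeOf α ⊥f          = ⊥
  TypeOf α (¬f φ)      = ¬ TypeOf α φ
  TypeOf α (φ ∧f ψ)    = TypeOf α φ × TypeOf α ψ
  TypeOf α (φ ∨f ψ)    = TypeOf α φ ⊎ TypeOf α ψ
  TypeOf α (φ ⇒f ψ)    = TypeOf α φ → TypeOf α ψ

  TypeOf-injective : ∀ α β → TypeOf α ≈ᶠ TypeOf β → α ≈* β
  TypeOf-injective α β (α⊆β , β⊆α) = (λ s → β⊆α (dle vx vy s)) , (λ s → α⊆β (dle vx vy s))

  pointModel : Structure
  pointModel = record { M = ⊤ ; D = λ _ _ _ → ⊤ }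

  pointModel-isModel : IsModelTMS pointModel o
  pointModel-isModel = record
    { ax-zero = λ _ _ → (λ _ → refl) , (λ _ → tt)
    ; ax-symm = λ _ _ _ → (λ _ → tt) , (λ _ → tt)
    ; ax-tri  = λ _ _ _ _ _ _ _ _ _ → tt
    ; ax-max  = λ _ _ _ _ → tt
    }

  twoPointModel : Cut → Structure
  twoPointModel α = record { M = Bool ; D = λ s a b → (a ≡ b) ⊎ X α s }

  module Classical (lem : ExcludedMiddle 0ℓ) (ι-injective : Injective _≡_ _≡_ ι) where

    realises-p⇒distance : ∀ 𝓝 {a b} α → Realises 𝓝 a b (p α) →
                          ∀ s → Structure.D 𝓝 s a b ⇔ X α s
    realises-p⇒distance 𝓝 α real s =
      mk⇔ D⇒X (λ s∈α → real (dle vx vy s) (inj₁ (s , ∈⇒≤*↑ α s∈α , refl)))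
      where
        D⇒X : Structure.D 𝓝 s _ _ → X α s
        D⇒X Dsab with lem {X α s}
        ... | yes s∈α = s∈α
        ... | no  s∉α = ⊥-elim (real (dgt vx vy s) (inj₂ (s , ∉⇒↑<* α s∉α , refl)) Dsab)

    holds⇔TypeOf : ∀ 𝓝 → IsModelTMS 𝓝 o → ∀ {a b} α → Realises 𝓝 a b (p α) →
                   ∀ φ → Holds 𝓝 φ a b ⇔ TypeOf α φ
    holds⇔TypeOf 𝓝 model {a} {b} α real = go
      where
        open Model 𝓝 model

        distance : ∀ s → Structure.D 𝓝 s a b ⇔ X α s
        distance = realises-p⇒distance 𝓝 α real

        dle⇔AtMost : ∀ u v s → Holds 𝓝 (dle u v s) a b ⇔ AtMost α u v s
        dle⇔AtMost vx vx s = mk⇔ (λ _ → tt) (λ _ → D-refl s a)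
        dle⇔AtMost vx vy s = distance s
        dle⇔AtMost vy vx s = distance s ⇔-∘ D-sym s b a
        dle⇔AtMost vy vy s = mk⇔ (λ _ → tt) (λ _ → D-refl s b)

        go : ∀ φ → Holds 𝓝 φ a b ⇔ TypeOf α φ
        go (u ≐ v)     = dle⇔AtMost u v o ⇔-∘ D-zero _ _
        go (dle u v s) = dle⇔AtMost u v s
        go ⊤f          = ⇔-id _
        go ⊥f          = ⇔-id _
        go (¬f φ)      = ¬-cong-⇔ (go φ)
        go (φ ∧f ψ)    = go φ ×-⇔ go ψ
        go (φ ∨f ψ)    = go φ ⊎-⇔ go ψ
        go (φ ⇒f ψ)    = →-cong-⇔ (go φ) (go ψ)

    complete-type≈TypeOf : ∀ {q} 𝓝 → IsModelTMS 𝓝 o → ∀ {a b} α → Complete q →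
                           Realises 𝓝 a b q → Realises 𝓝 a b (p α) → q ≈ᶠ TypeOf α
    complete-type≈TypeOf 𝓝 model α q-complete q-real p-real =
        (λ φ qφ → to (holds⇔ φ) (q-real φ qφ))
      , (λ φ tφ → complete-realised-maximal 𝓝 q-complete q-real φ (from (holds⇔ φ) tφ))
      where holds⇔ = holds⇔TypeOf 𝓝 model α p-real

    ∈-across-gap : ∀ α {t u B} → Gap t B → X α u → ι u ≤ B → X α t
    ∈-across-gap α {t} {u} gap u∈α u≤B with lem {X α t}
    ... | yes t∈α = t∈α
    ... | no  t∉α = ⊥-elim (gap (u , (∈-below-∉ α t∉α u∈α , t≢u) , u≤B))
      where
        t≢u : ¬ ι t ≡ ι u
        t≢u ιt≡ιu = t∉α (subst (X α) (sym (ι-injective ιt≡ιu)) u∈α)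

    twoPointModel-isModel : ∀ α → ¬ X α o → IsModelTMS (twoPointModel α) o
    twoPointModel-isModel α o∉α = record
      { ax-zero = λ _ _ → (λ { (inj₁ a≡b) → a≡b ; (inj₂ o∈α) → ⊥-elim (o∉α o∈α) }) , inj₁
      ; ax-symm = λ _ _ _ → swap , swap
      ; ax-tri  = tri
      ; ax-max  = λ m m-max _ _ → inj₂ (has-max α m m-max)
      }
      where
        swap : ∀ {A : Set} {a b : Bool} → (a ≡ b) ⊎ A → (b ≡ a) ⊎ A
        swap (inj₁ a≡b) = inj₁ (sym a≡b)
        swap (inj₂ x)   = inj₂ x

        tri : ∀ r s t → Gap t (ι r ⊕ ι s) → ∀ (a b c : Bool) →
              (a ≡ b) ⊎ X α r → (b ≡ c) ⊎ X α s → (a ≡ c) ⊎ X α t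
        tri r s t gap a b c (inj₁ refl) (inj₁ refl) = inj₁ refl
        tri r s t gap a b c (inj₁ refl) (inj₂ s∈α)  =
          inj₂ (∈-across-gap α gap s∈α (subst (ι s ≤_) (⊕-comm (ι s) (ι r)) (≤-⊕ (ι s) (ι r))))
        tri r s t gap a b c (inj₂ r∈α)  _           =
          inj₂ (∈-across-gap α gap r∈α (≤-⊕ (ι r) (ι s)))

    p-consistent : ∀ α → ConsistentWithTMS o (p α)
    p-consistent α with lem {X α o}
    ... | yes o∈α = pointModel , pointModel-isModel , tt , tt ,
          distance⇒realises-p pointModel α
            (λ s → mk⇔ (λ _ → upward α o∈α (o-minimum s)) (λ _ → tt))
    ... | no  o∉α = twoPointModel α , twoPointModel-isModel α o∉α , true , false ,
          distance⇒realises-p (twoPointModel α) α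
            (λ s → mk⇔ (λ { (inj₁ ()) ; (inj₂ s∈α) → s∈α }) inj₂)

    p⊆TypeOf : ∀ α → p α ⊆ᶠ TypeOf α
    p⊆TypeOf α φ pφ =
      let (𝓝 , model , a , b , real) = p-consistent α
      in to (holds⇔TypeOf 𝓝 model α real φ) (real φ pφ)

    TypeOf-consistent : ∀ α → ConsistentWithTMS o (TypeOf α)
    TypeOf-consistent α =
      let (𝓝 , model , a , b , real) = p-consistent α
      in 𝓝 , model , a , b , λ φ → from (holds⇔TypeOf 𝓝 model α real φ)

    TypeOf-complete : ∀ α → Complete (TypeOf α)
    TypeOf-complete α φ = toSum lem

    TypeOf-unique : ∀ α q → IsCompleteQFType o q → p α ⊆ᶠ q → q ≈ᶠ TypeOf α
    TypeOf-unique α q (q-complete , 𝓝 , model , a , b , q-real) p⊆q =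
      complete-type≈TypeOf 𝓝 model α q-complete q-real (λ φ pφ → q-real φ (p⊆q φ pφ))

    TypeOf-surjective : ∀ q → IsCompleteQFType o q → Σ[ α ∈ Cut ] (q ≈ᶠ TypeOf α)
    TypeOf-surjective q (q-complete , 𝓝 , model , a , b , q-real) =
      distanceCut a b , complete-type≈TypeOf 𝓝 model (distanceCut a b) q-complete q-real
                                             (distanceCut-realised a b)
      where open Model 𝓝 model

proposition2p7 : ExcludedMiddle 0ℓ → ExcludedMiddle (lsuc 0ℓ) →
    (𝓡 : DistanceMagma) (S : Set) (ι : S → DistanceMagma.R 𝓡) →
    Injective _≡_ _≡_ ι →
    (o : S) → ι o ≡ DistanceMagma.𝟘 𝓡 →
    let open Setup 𝓡 S ι in
    Σ[ F ∈ (Cut → Σ[ q ∈ QFSet ] IsCompleteQFType o q) ]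
    ((∀ α → p α ⊆ᶠ proj₁ (F α))
    × (∀ α (q : QFSet) → IsCompleteQFType o q → p α ⊆ᶠ q → q ≈ᶠ proj₁ (F α))
    × (∀ α β → proj₁ (F α) ≈ᶠ proj₁ (F β) → α ≈* β)
    × (∀ (q : QFSet) → IsCompleteQFType o q → Σ[ α ∈ Cut ] (q ≈ᶠ proj₁ (F α))))
proposition2p7 lem _ 𝓡 S ι ι-injective o ιo≡𝟘 =
    (λ α → TypeOf α , TypeOf-complete α , TypeOf-consistent α)
  , p⊆TypeOf
  , TypeOf-unique
  , TypeOf-injective
  , TypeOf-surjective
  where
    open CutTypes 𝓡 S ι o ιo≡𝟘
    open Classical lem ι-injective
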